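{- Let $G$ be a graph containing no subgraph isomorphic to $C_6$ and let $x\in V(G)$. Then $x$ is not extendable in $G$ if and only if $x$ is not extendable in $H_x$.
   Context: Graphs are finite, simple, undirected. For a nonempty set $S$ of vertices of a graph, $N(S)$ (resp. $N[S]$) is the set of vertices at distance exactly $1$ (resp. at most $1$) from $S$; $N_2(x)$ (resp. $N_2[x]$) is the set of vertices at distance exactly $2$ (resp. at most $2$) from $x$; $N[\emptyset]=\emptyset$. A set $S$ dominates $T$ if $T\subseteq N[S]$. A vertex $v$ of a graph $H$ is extendable in $H$ if there is no independent set $S\subseteq N_2(v)$ which dominates $N(v)$, all neighborhoods being taken in $H$. "No subgraph isomorphic to $C_6$" refers to not necessarily induced subgraphs. Let $A^*$ be the set of all connected components $A$ of $G[N_2(x)]$ (neighborhoods in $G$) for which there exists a vertex $a\in V(A)$ with $N(x)\cap N(a)=N(x)\cap N(V(A))$, let $V(A^*)$ be the union of the vertex sets of the components in $A^*$, and let $H_x=G[N_2[x]\setminus N[V(A^*)]]$ (neighborhoods in $G$). -}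

module Defs where

open import Data.Nat using (ℕ)
open import Data.Fin using (Fin; zero; suc)
open import Data.Bool using (Bool; true; false; T)
open import Data.Fin.Subset using (Subset) renaming (_∈_ to _∈ₛ_)
open import Data.Product using (Σ; ∃; _×_; _,_)
open import Data.Sum using (_⊎_)
open import Data.Unit using (⊤)
open import Relation.Nullary using (¬_)
open import Relation.Binary.PropositionalEquality using (_≡_; _≢_)

record Graph (n : ℕ) : Set where
  field
    edge   : Fin n → Fin n → Bool
    sym    : ∀ u v → edge u v ≡ edge v u
    irrefl : ∀ v → edge v v ≡ false

module _ {n : ℕ} (G : Graph n) where
  open Graph G

  Adj : Fin n → Fin n → Set
  Adj u v = T (edge u v)

  N : (Fin n → Set) → Fin n → Set
  N S v = ¬ S v × ∃ λ s → S s × Adj s v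

  N[_] : (Fin n → Set) → Fin n → Set
  N[ S ] v = S v ⊎ N S v

  Nv : Fin n → Fin n → Set
  Nv a u = Adj a u

  N₂ : Fin n → Fin n → Set
  N₂ x u = u ≢ x × ¬ Adj x u × ∃ λ w → Adj x w × Adj w u

  N₂[_] : Fin n → Fin n → Set
  N₂[ x ] u = u ≡ x ⊎ Adj x u ⊎ N₂ x u

  AdjIn : (Fin n → Set) → Fin n → Fin n → Set
  AdjIn W u v = W u × W v × Adj u v

  NIn : (Fin n → Set) → Fin n → Fin n → Set
  NIn W v u = AdjIn W v u

  N₂In : (Fin n → Set) → Fin n → Fin n → Set
  N₂In W v u = W u × u ≢ v × ¬ AdjIn W v u × ∃ λ w → AdjIn W v w × AdjIn W w u

  -- S (a subset of V(G), meant to lie inside W) is independent in G[W]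
  IndependentIn : (Fin n → Set) → Subset n → Set
  IndependentIn W S = ∀ s t → s ∈ₛ S → t ∈ₛ S → ¬ AdjIn W s t

  DominatesIn : (Fin n → Set) → Subset n → (Fin n → Set) → Set
  DominatesIn W S T = ∀ u → T u → ∃ λ s → s ∈ₛ S × (s ≡ u ⊎ AdjIn W s u)

  ExtendableIn : (Fin n → Set) → Fin n → Set
  ExtendableIn W v =
    ¬ (Σ (Subset n) λ S →
         (∀ s → s ∈ₛ S → N₂In W v s) × IndependentIn W S × DominatesIn W S (NIn W v))

  All : Fin n → Set
  All _ = ⊤

  Extendable : Fin n → Set
  Extendable v = ExtendableIn All v

  data Reach (W : Fin n → Set) : Fin n → Fin n → Set where
    here : ∀ {u} → W u → Reach W u u
    step : ∀ {u v w} → AdjIn W u v → Reach W v w → Reach W u w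

  -- vertex set V(A) of the component of G[N_2(x)] containing u
  Comp : Fin n → Fin n → Fin n → Set
  Comp x u b = Reach (N₂ x) u b

  -- the component A of G[N_2(x)] containing u belongs to A*:
  -- ∃ a ∈ V(A) with N(x) ∩ N(a) = N(x) ∩ N(V(A))
  InAStar : Fin n → Fin n → Set
  InAStar x u = ∃ λ a → Comp x u a ×
    (∀ y → ((Nv x y × Nv a y) → (Nv x y × N (Comp x u) y))
         × ((Nv x y × N (Comp x u) y) → (Nv x y × Nv a y)))

  VAStar : Fin n → Fin n → Set
  VAStar x u = N₂ x u × InAStar x u

  HxV : Fin n → Fin n → Set
  HxV x u = N₂[ x ] u × ¬ N[ VAStar x ] u

  next6 : Fin 6 → Fin 6
  next6 zero = suc zero
  next6 (suc zero) = suc (suc zero)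
  next6 (suc (suc zero)) = suc (suc (suc zero))
  next6 (suc (suc (suc zero))) = suc (suc (suc (suc zero)))
  next6 (suc (suc (suc (suc zero)))) = suc (suc (suc (suc (suc zero))))
  next6 (suc (suc (suc (suc (suc zero))))) = zero

  -- G has a (not necessarily induced) subgraph isomorphic to C_6
  HasC6 : Set
  HasC6 = Σ (Fin 6 → Fin n) λ f →
    (∀ i j → f i ≡ f j → i ≡ j) × (∀ i → Adj (f i) (f (next6 i)))

module Submission where

-- Let W be the vertex set of H_x.  Call S ⊆ V(G) an obstruction for x in G[W] if S is an
-- independent set of G[W] inside N₂(x) (taken in G[W]) that dominates N(x) (taken in G[W]);
-- x is non-extendable in G[W] exactly when an obstruction exists.  We turn obstructions of
-- one graph into obstructions of the other.
--  (⇒) If S is an obstruction in G, then S ∩ N₂_{H_x}(x) is one in H_x: a neighbour u of x in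
--      H_x is dominated by some s ∈ S, and s lies in H_x, for s ∈ N[V(A*)] would force
--      u ∈ N[V(A*)] (V(A*) is a union of components of G[N₂(x)], hence closed under adjacency
--      inside N₂(x)).
--  (⇐) If S is an obstruction in H_x, add to it a representative of every component A ∈ A*:
--      the vertex of least index among those a ∈ V(A) with N(x) ∩ N(a) = N(x) ∩ N(V(A)).
--      Representatives of distinct components are non-adjacent and S avoids N[V(A*)], so the
--      union is independent; a neighbour of x outside H_x lies in N(V(A)) for some A ∈ A* and
--      is therefore adjacent to the representative of A.
-- Forming these sets needs decidable predicates; since the goals are negations, classical
-- reasoning over the finite vertex set is available through double negation.  The argument
-- does not use C₆-freeness.

open import Defs
open import Data.Nat using (ℕ; zero; suc)
import Data.Nat as ℕ
open import Data.Nat.Properties using (≰⇒>)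
open import Data.Fin using (Fin; zero; suc; toℕ; fromℕ<; inject; _≤_)
open import Data.Fin.Properties using (toℕ-injective; toℕ-inject; toℕ-fromℕ<; ≤-antisym; ¬∀⟶∃¬-smallest)
open import Data.Fin.Subset using (Subset; _∩_; _∪_) renaming (_∈_ to _∈ₛ_)
open import Data.Fin.Subset.Properties using (x∈p∩q⁺; x∈p∩q⁻; x∈p∪q⁺; x∈p∪q⁻)
open import Data.Vec using (tabulate)
open import Data.Vec.Properties using (lookup∘tabulate; []=⇒lookup; lookup⇒[]=)
open import Data.Bool using (T)
open import Data.Bool.Properties using (T-≡)
open import Data.Product using (Σ; ∃; _×_; _,_; proj₁; proj₂)
open import Data.Sum using (_⊎_; inj₁; inj₂)
open import Data.Unit using (tt)
open import Data.Empty using (⊥-elim)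
open import Function using (_∘_)
open import Function.Bundles using (Equivalence)
open import Relation.Nullary using (¬_; yes; no; contradiction)
open import Relation.Nullary.Decidable using (isYes; toWitness; fromWitness; decidable-stable; ¬?; ¬¬-excluded-middle)
open import Relation.Unary using (Decidable)
open import Relation.Binary.PropositionalEquality using (_≡_; refl; sym; trans; subst)

¬¬-∀Fin : ∀ {m} {P : Fin m → Set} → (∀ i → ¬ ¬ P i) → ¬ ¬ (∀ i → P i)
¬¬-∀Fin {zero}  h k = k (λ ())
¬¬-∀Fin {suc m} h k =
  h zero λ p₀ → ¬¬-∀Fin (h ∘ suc) λ ps → k λ { zero → p₀ ; (suc i) → ps i }

¬¬-decidable : ∀ {m} (P : Fin m → Set) → ¬ ¬ Decidable P
¬¬-decidable P = ¬¬-∀Fin (λ i → ¬¬-excluded-middle)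

subsetOf : ∀ {m} {P : Fin m → Set} → Decidable P → Subset m
subsetOf P? = tabulate (isYes ∘ P?)

∈-subsetOf⁻ : ∀ {m} {P : Fin m → Set} (P? : Decidable P) {i} → i ∈ₛ subsetOf P? → P i
∈-subsetOf⁻ P? {i} i∈ = toWitness (Equivalence.from T-≡
  (trans (sym (lookup∘tabulate (isYes ∘ P?) i)) ([]=⇒lookup i∈)))

∈-subsetOf⁺ : ∀ {m} {P : Fin m → Set} (P? : Decidable P) {i} → P i → i ∈ₛ subsetOf P?
∈-subsetOf⁺ P? {i} p = lookup⇒[]= i (subsetOf P?)
  (trans (lookup∘tabulate (isYes ∘ P?) i) (Equivalence.to T-≡ (fromWitness p)))

least : ∀ {m} {P : Fin m → Set} → Decidable P → ∀ {b} → P b →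
        ∃ λ a → P a × (∀ c → P c → a ≤ c)
least {m} {P} P? {b} pb with ¬∀⟶∃¬-smallest m (¬_ ∘ P) (¬? ∘ P?) (λ none → none b pb)
... | a , ¬¬pa , below = a , decidable-stable (P? a) ¬¬pa , minimal
  where
    minimal : ∀ c → P c → a ≤ c
    minimal c pc with toℕ a ℕ.≤? toℕ c
    ... | yes a≤c = a≤c
    ... | no  a≰c = ⊥-elim (below j (subst P (sym inject-j≡c) pc))
      where
        j : Fin (toℕ a)
        j = fromℕ< (≰⇒> a≰c)
        inject-j≡c : inject j ≡ c
        inject-j≡c = toℕ-injective (trans (toℕ-inject j) (toℕ-fromℕ< (≰⇒> a≰c)))

module GraphFacts {n : ℕ} (G : Graph n) where
  open Graph G using () renaming (sym to edge-sym; irrefl to edge-irrefl)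

  adj-sym : ∀ {u v} → Adj G u v → Adj G v u
  adj-sym {u} {v} = subst T (edge-sym u v)

  adj-irrefl : ∀ {v} → ¬ Adj G v v
  adj-irrefl {v} = subst T (edge-irrefl v)

  reach-end : ∀ {W u v} → Reach G W u v → W v
  reach-end (here w)   = w
  reach-end (step _ r) = reach-end r

  reach-trans : ∀ {W u v w} → Reach G W u v → Reach G W v w → Reach G W u w
  reach-trans (here _)   r′ = r′
  reach-trans (step a r) r′ = step a (reach-trans r r′)

  reach-adj : ∀ {W u v} → W u → W v → Adj G u v → Reach G W u v
  reach-adj wu wv a = step (wu , wv , a) (here wv)

  reach-sym : ∀ {W u v} → Reach G W u v → Reach G W v u
  reach-sym (here w)                 = here w
  reach-sym (step (wu , wv , a) r) = reach-trans (reach-sym r) (reach-adj wv wu (adj-sym a))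

  N₂In⇒N₂ : ∀ {W v s} → N₂In G W v s → N₂ G v s
  N₂In⇒N₂ (ws , s≢v , ¬adj , w , (wv , _ , avw) , (_ , _ , aws)) =
    s≢v , (λ avs → ¬adj (wv , ws , avs)) , w , avw , aws

  N₂⇒N₂In : ∀ {W v w s} → W v → W w → W s → N₂ G v s → Adj G v w → Adj G w s → N₂In G W v s
  N₂⇒N₂In wv ww ws (s≢v , ¬avs , _) avw aws =
    ws , s≢v , (λ q → ¬avs (proj₂ (proj₂ q))) , _ , (wv , ww , avw) , (ww , ws , aws)

  N₂⇒N₂In-All : ∀ {v s} → N₂ G v s → N₂In G (All G) v s
  N₂⇒N₂In-All n₂@(_ , _ , _ , avw , aws) = N₂⇒N₂In tt tt tt n₂ avw aws

  Obstruction : (Fin n → Set) → Fin n → Subset n → Set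
  Obstruction W v S =
    (∀ s → s ∈ₛ S → N₂In G W v s) × IndependentIn G W S × DominatesIn G W S (NIn G W v)

  ¬extendable-transfer : ∀ {W W′ v} →
    (∀ S → Obstruction W v S → ¬ ¬ Σ (Subset n) (Obstruction W′ v)) →
    ¬ ExtendableIn G W v → ¬ ExtendableIn G W′ v
  ¬extendable-transfer obstruct h e = h λ { (S , ob) → obstruct S ob e }

module AStar {n : ℕ} (G : Graph n) (x : Fin n) where
  open GraphFacts G

  W : Fin n → Set
  W = HxV G x

  C : Fin n → Fin n → Set
  C = Comp G x

  Captures : Fin n → (Fin n → Set) → Set
  Captures a K = ∀ y → ((Nv G x y × Nv G a y) → (Nv G x y × N G K y))
                     × ((Nv G x y × N G K y) → (Nv G x y × Nv G a y))

  N₂-¬adj : ∀ {u} → N₂ G x u → ¬ Adj G x u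
  N₂-¬adj = proj₁ ∘ proj₂

  -- Any two vertices of a component determine the same component, hence the same
  -- neighbourhood N(V(A)); so Captures and membership in A* depend only on the component.
  N-comp-transport : ∀ {u t y} → C u t → N G (C u) y → N G (C t) y
  N-comp-transport c (∉ , b , cub , aby) =
    (λ cty → ∉ (reach-trans c cty)) , b , reach-trans (reach-sym c) cub , aby

  Captures-transport : ∀ {a u t} → C u t → Captures a (C u) → Captures a (C t)
  Captures-transport c cap y =
    (λ p → let (axy , nuy) = proj₁ (cap y) p in axy , N-comp-transport c nuy) ,
    (λ { (axy , nty) → proj₂ (cap y) (axy , N-comp-transport (reach-sym c) nty) })

  InAStar-transport : ∀ {s t} → C s t → InAStar G x t → InAStar G x s
  InAStar-transport c (a , cta , cap) = a , reach-trans c cta , Captures-transport (reach-sym c) cap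

  -- V(A*) is a union of components, so a vertex of N₂(x) adjacent to V(A*) is in V(A*).
  VAStar-closed : ∀ {s t} → N₂ G x s → VAStar G x t → Adj G s t → VAStar G x s
  VAStar-closed n₂s (n₂t , ia) ast =
    n₂s , InAStar-transport (reach-adj n₂s n₂t ast) ia

  N₂-outside-VAStar : ∀ {s} → N₂ G x s → ¬ VAStar G x s → ¬ N[_] G (VAStar G x) s
  N₂-outside-VAStar n₂s ∉ (inj₁ vs)                = ∉ vs
  N₂-outside-VAStar n₂s ∉ (inj₂ (_ , t , vt , ats)) = ∉ (VAStar-closed n₂s vt (adj-sym ats))

  W-centre : W x
  W-centre = inj₁ refl , λ
    { (inj₁ vx)                  → proj₁ (proj₁ vx) refl
    ; (inj₂ (_ , t , vt , atx)) → N₂-¬adj (proj₁ vt) (adj-sym atx) }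

  W-dominator : ∀ {u s} → W u → Adj G x u → N₂ G x s → Adj G s u → W s
  W-dominator {s = s} (_ , u∉) axu n₂s asu = inj₂ (inj₂ n₂s) , N₂-outside-VAStar n₂s s∉
    where
      s∉ : ¬ VAStar G x s
      s∉ vs = u∉ (inj₂ ((λ vu → N₂-¬adj (proj₁ vu) axu) , _ , vs , asu))

  restrict : ∀ S → Obstruction (All G) x S → (N₂W? : Decidable (N₂In G W x)) →
             Obstruction W x (S ∩ subsetOf N₂W?)
  restrict S (inN₂ , indep , dom) N₂W? = inN₂′ , indep′ , dom′
    where
      S′ : Subset n
      S′ = S ∩ subsetOf N₂W?

      inN₂′ : ∀ s → s ∈ₛ S′ → N₂In G W x s
      inN₂′ s m = ∈-subsetOf⁻ N₂W? (proj₂ (x∈p∩q⁻ S _ m))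

      indep′ : IndependentIn G W S′
      indep′ s t ms mt (_ , _ , ast) =
        indep s t (proj₁ (x∈p∩q⁻ S _ ms)) (proj₁ (x∈p∩q⁻ S _ mt)) (tt , tt , ast)

      dom′ : DominatesIn G W S′ (NIn G W x)
      dom′ u (wx , wu , axu) with dom u (tt , tt , axu)
      ... | s , ms , inj₁ refl = contradiction axu (N₂-¬adj (N₂In⇒N₂ (inN₂ s ms)))
      ... | s , ms , inj₂ (_ , _ , asu) =
        s , x∈p∩q⁺ (ms , ∈-subsetOf⁺ N₂W? (N₂⇒N₂In wx wu ws n₂s axu (adj-sym asu))) ,
        inj₂ (ws , wu , asu)
        where
          n₂s : N₂ G x s
          n₂s = N₂In⇒N₂ (inN₂ s ms)
          ws : W s
          ws = W-dominator wu axu n₂s asu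

  Good : Fin n → Set
  Good a = N₂ G x a × Captures a (C a)

  Rep : Fin n → Set
  Rep a = Good a × (∀ b → C a b → Good b → a ≤ b)

  good⇒VAStar : ∀ {a} → Good a → VAStar G x a
  good⇒VAStar (n₂a , cap) = n₂a , _ , here n₂a , cap

  rep-exists : (CG? : ∀ t → Decidable (λ b → C t b × Good b)) →
               ∀ {t} → VAStar G x t → ∃ λ r → Rep r × C t r
  rep-exists CG? {t} (_ , a , cta , cap)
    with least (CG? t) (cta , reach-end cta , Captures-transport cta cap)
  ... | r , (ctr , good-r) , minimal =
    r , (good-r , λ b crb good-b → minimal b (reach-trans ctr crb , good-b)) , ctr

  -- Distinct representatives lie in distinct components, hence are non-adjacent.
  reps-independent : ∀ {s t} → Rep s → Rep t → ¬ Adj G s t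
  reps-independent {s} {t} (good-s , min-s) (good-t , min-t) ast =
    adj-irrefl (subst (Adj G s) (sym s≡t) ast)
    where
      cst : C s t
      cst = reach-adj (proj₁ good-s) (proj₁ good-t) ast
      s≡t : s ≡ t
      s≡t = ≤-antisym (min-s t cst good-t) (min-t s (reach-sym cst) good-s)

  -- H_x avoids N[V(A*)], so no vertex of H_x is adjacent to a good vertex.
  W-¬adj-good : ∀ {s a} → W s → Good a → ¬ Adj G a s
  W-¬adj-good (_ , s∉) good-a aas =
    s∉ (inj₂ ((λ vs → s∉ (inj₁ vs)) , _ , good⇒VAStar good-a , aas))

  rep-dominates : (CG? : ∀ t → Decidable (λ b → C t b × Good b)) →
                  ∀ {u} → Adj G x u → N[_] G (VAStar G x) u → ∃ λ r → Rep r × Adj G r u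
  rep-dominates CG? axu (inj₁ vu) = contradiction axu (N₂-¬adj (proj₁ vu))
  rep-dominates CG? {u} axu (inj₂ (_ , t , vt , atu)) with rep-exists CG? vt
  ... | r , rep-r@((_ , cap) , _) , ctr = r , rep-r , proj₂ (proj₂ (cap u) (axu , u∈N[Cr]))
    where
      u∈N[Cr] : N G (C r) u
      u∈N[Cr] = (λ cru → N₂-¬adj (reach-end cru) axu) , t , reach-sym ctr , atu

  extend : ∀ S → Obstruction W x S → (Rep? : Decidable Rep) →
           (CG? : ∀ t → Decidable (λ b → C t b × Good b)) →
           (NV? : Decidable (N[_] G (VAStar G x))) →
           Obstruction (All G) x (S ∪ subsetOf Rep?)
  extend S (inN₂ , indep , dom) Rep? CG? NV? = inN₂′ , indep′ , dom′
    where
      R : Subset n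
      R = subsetOf Rep?
      S′ : Subset n
      S′ = S ∪ R

      inN₂′ : ∀ s → s ∈ₛ S′ → N₂In G (All G) x s
      inN₂′ s m with x∈p∪q⁻ S R m
      ... | inj₁ ms = N₂⇒N₂In-All (N₂In⇒N₂ (inN₂ s ms))
      ... | inj₂ mr = N₂⇒N₂In-All (proj₁ (proj₁ (∈-subsetOf⁻ Rep? mr)))

      indep′ : IndependentIn G (All G) S′
      indep′ s t ms mt (_ , _ , ast) with x∈p∪q⁻ S R ms | x∈p∪q⁻ S R mt
      ... | inj₁ s∈S | inj₁ t∈S =
        indep s t s∈S t∈S (proj₁ (inN₂ s s∈S) , proj₁ (inN₂ t t∈S) , ast)
      ... | inj₁ s∈S | inj₂ t∈R =
        W-¬adj-good (proj₁ (inN₂ s s∈S)) (proj₁ (∈-subsetOf⁻ Rep? t∈R)) (adj-sym ast)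
      ... | inj₂ s∈R | inj₁ t∈S =
        W-¬adj-good (proj₁ (inN₂ t t∈S)) (proj₁ (∈-subsetOf⁻ Rep? s∈R)) ast
      ... | inj₂ s∈R | inj₂ t∈R =
        reps-independent (∈-subsetOf⁻ Rep? s∈R) (∈-subsetOf⁻ Rep? t∈R) ast

      dom′ : DominatesIn G (All G) S′ (NIn G (All G) x)
      dom′ u (_ , _ , axu) with NV? u
      ... | yes nv with rep-dominates CG? axu nv
      ...   | r , rep-r , aru = r , x∈p∪q⁺ (inj₂ (∈-subsetOf⁺ Rep? rep-r)) , inj₂ (tt , tt , aru)
      dom′ u (_ , _ , axu) | no ¬nv with dom u (W-centre , (inj₂ (inj₁ axu) , ¬nv) , axu)
      ... | s , ms , inj₁ s≡u          = s , x∈p∪q⁺ (inj₁ ms) , inj₁ s≡u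
      ... | s , ms , inj₂ (_ , _ , asu) = s , x∈p∪q⁺ (inj₁ ms) , inj₂ (tt , tt , asu)

  restrict-classically : ∀ S → Obstruction (All G) x S → ¬ ¬ Σ (Subset n) (Obstruction W x)
  restrict-classically S ob k = ¬¬-decidable _ λ N₂W? → k (_ , restrict S ob N₂W?)

  extend-classically : ∀ S → Obstruction W x S → ¬ ¬ Σ (Subset n) (Obstruction (All G) x)
  extend-classically S ob k =
    ¬¬-decidable Rep λ Rep? →
    ¬¬-∀Fin (λ t → ¬¬-decidable _) λ CG? →
    ¬¬-decidable _ λ NV? →
    k (_ , extend S ob Rep? CG? NV?)

lemma6 : ∀ {n : ℕ} (G : Graph n) → ¬ HasC6 G → (x : Fin n) →
    ((¬ Extendable G x → ¬ ExtendableIn G (HxV G x) x)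
    × (¬ ExtendableIn G (HxV G x) x → ¬ Extendable G x))
lemma6 G _ x =
  ¬extendable-transfer restrict-classically , ¬extendable-transfer extend-classically
  where
    open GraphFacts G
    open AStar G x
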